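{- Let $P$ be a $\mathrm{CCS}^{ - }_{\mathrm{core}}$ process. Whenever $!P\Rightarrow P'$ (i.e. $!P$ reaches $P'$ by zero or more $\tau$-transitions), it holds that $!P\approx P'$.
   Context: $\mathrm{CCS}^{ - }_{\mathrm{core}}$ has processes $P,Q ::= 0 \mid a.P \mid \overline{a}.P \mid P\,|\,Q \mid\ !P$. Actions: $a$, $\overline a$, $\tau$. Transition rules: $a.P\xrightarrow{a}P$; $\overline{a}.P\xrightarrow{\overline a}P$; if $P\xrightarrow{\alpha}P'$ then $P|Q\xrightarrow{\alpha}P'|Q$ and $Q|P\xrightarrow{\alpha}Q|P'$; if $P\xrightarrow{\overline a}P'$, $Q\xrightarrow{a}Q'$ then $P|Q\xrightarrow{\tau}P'|Q'$ and $Q|P\xrightarrow{\tau}Q'|P'$; if $P\xrightarrow{\alpha}P'$ then $!P\xrightarrow{\alpha}P'|\,!P$; if $P\xrightarrow{a}P'$ and $P\xrightarrow{\overline a}P''$ then $!P\xrightarrow{\tau}P'|P''|\,!P$. $\Rightarrow$ is the reflexive transitive closure of $\xrightarrow{\tau}$; $\overset{\hat\alpha}{\Rightarrow}$ is $\Rightarrow$ if $\alpha=\tau$, else $\Rightarrow\xrightarrow{\alpha}\Rightarrow$. $P$ is divergent if it has an infinite $\tau$-sequence; $\mathcal R$ is divergence-sensitive if $P\mathcal RQ$ implies ($P$ divergent iff $Q$ divergent). A weak bisimulation is a symmetric divergence-sensitive relation $\mathcal R$ such that $P\mathcal RQ$, $P\xrightarrow{\alpha}P'$ imply $Q\overset{\hat\alpha}{\Rightarrow}Q'$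 with $P'\mathcal RQ'$; $\approx$ is the union of all weak bisimulations. -}

module Defs where

open import Level using (0ℓ)
open import Data.Nat using (ℕ; suc)
open import Data.Product using (Σ; ∃; _×_; _,_)
open import Relation.Binary using (Rel; Symmetric)
open import Relation.Binary.PropositionalEquality using (_≡_)
open import Relation.Binary.Construct.Closure.ReflexiveTransitive using (Star)

Name : Set
Name = ℕ

data Proc : Set where
  𝟎    : Proc
  inp  : Name → Proc → Proc
  out  : Name → Proc → Proc
  _∥_  : Proc → Proc → Proc
  !_   : Proc → Proc

infixr 5 _∥_
infix 6 !_

data Act : Set where
  ι  : Name → Act
  ō  : Name → Act
  τ  : Act

data _—[_]→_ : Proc → Act → Proc → Set where
  input   : ∀ {a P} → inp a P —[ ι a ]→ P
  output  : ∀ {a P} → out a P —[ ō a ]→ P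
  parL    : ∀ {P P' Q α} → P —[ α ]→ P' → (P ∥ Q) —[ α ]→ (P' ∥ Q)
  parR    : ∀ {P P' Q α} → P —[ α ]→ P' → (Q ∥ P) —[ α ]→ (Q ∥ P')
  commL   : ∀ {P P' Q Q' a} → P —[ ō a ]→ P' → Q —[ ι a ]→ Q' →
            (P ∥ Q) —[ τ ]→ (P' ∥ Q')
  commR   : ∀ {P P' Q Q' a} → P —[ ō a ]→ P' → Q —[ ι a ]→ Q' →
            (Q ∥ P) —[ τ ]→ (Q' ∥ P')
  rep     : ∀ {P P' α} → P —[ α ]→ P' → (! P) —[ α ]→ (P' ∥ ! P)
  repComm : ∀ {P P' P'' a} → P —[ ι a ]→ P' → P —[ ō a ]→ P'' →
            (! P) —[ τ ]→ (P' ∥ P'' ∥ ! P)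

_—τ→_ : Rel Proc 0ℓ
P —τ→ Q = P —[ τ ]→ Q

_⇒_ : Rel Proc 0ℓ
_⇒_ = Star _—τ→_

_=[_]⇒_ : Proc → Act → Proc → Set
P =[ ι a ]⇒ Q = ∃ λ R → ∃ λ R' → (P ⇒ R) × (R —[ ι a ]→ R') × (R' ⇒ Q)
P =[ ō a ]⇒ Q = ∃ λ R → ∃ λ R' → (P ⇒ R) × (R —[ ō a ]→ R') × (R' ⇒ Q)
P =[ τ ]⇒ Q   = P ⇒ Q

Divergent : Proc → Set
Divergent P = Σ (ℕ → Proc) λ f → (f 0 ≡ P) × (∀ n → f n —τ→ f (suc n))

DivergenceSensitive : Rel Proc 0ℓ → Set
DivergenceSensitive R =
  ∀ {P Q} → R P Q → (Divergent P → Divergent Q) × (Divergent Q → Divergent P)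

record IsWeakBisim (R : Rel Proc 0ℓ) : Set where
  field
    sym       : Symmetric R
    divSens   : DivergenceSensitive R
    simulate  : ∀ {P Q α P'} → R P Q → P —[ α ]→ P' →
                ∃ λ Q' → (Q =[ α ]⇒ Q') × R P' Q'

_≈_ : Rel Proc (Level.suc 0ℓ)
P ≈ Q = ∃ λ (R : Rel Proc 0ℓ) → IsWeakBisim R × R P Q

module Submission where

open import Defs
open import Data.Nat using (ℕ; zero; suc)
open import Data.Empty using (⊥; ⊥-elim)
open import Data.Product using (Σ; ∃; _×_; _,_; proj₁; proj₂)
open import Data.Sum using (_⊎_; inj₁; inj₂)
open import Data.List using (List; []; _∷_; _++_; [_])
open import Data.List.Properties using (++-identityʳ; ++-assoc)
open import Data.List.Membership.Propositional using (_∈_)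
open import Data.List.Membership.Propositional.Properties using (∈-∃++; ∈-++⁻; ∈-++⁺ˡ; ∈-++⁺ʳ)
open import Data.List.Relation.Unary.Any using (here; there)
open import Data.List.Relation.Binary.Permutation.Propositional
  using (_↭_; ↭-refl; ↭-sym; ↭-trans; ↭-reflexive; prep)
open import Data.List.Relation.Binary.Permutation.Propositional.Properties
  using (↭-length; ↭-singleton-inv; ∈-resp-↭; drop-∷; ++⁺ˡ; ++⁺ʳ; ++⁺; shift; shifts; ++-commutativeMonoid)
open import Relation.Binary.PropositionalEquality using (_≡_; refl; sym)
open import Relation.Binary.Construct.Closure.ReflexiveTransitive using (ε; _◅_; _◅◅_)
open import Algebra.Solver.CommutativeMonoid (++-commutativeMonoid {A = Proc})

-- Relate A and B when, up to associativity and commutativity of ∥, A = !P | D | G and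
-- B = !P | D | H, where G and H are residues left by τ-runs of !P.  Using its copy of !P,
-- B can silently produce G and so reach A | H; there it answers every move of A inside
-- the untouched context H.  Replicated components survive every transition, so the
-- successors are again related (with residue H on one side and none on the other),
-- and divergence of A transfers to B in the same way.

-- Component lists compared up to ↭ model structural congruence for associativity and
-- commutativity of ∥.
components : Proc → List Proc
components (A ∥ B) = components A ++ components B
components A       = [ A ]

module _ {a} {X : Set a} where

  infixr 4 _⟫_
  _⟫_ : ∀ {xs ys zs : List X} → xs ↭ ys → ys ↭ zs → xs ↭ zs
  _⟫_ = ↭-trans

  ∈⇒↭∷ : ∀ {x : X} {L} → x ∈ L → ∃ λ K → L ↭ x ∷ K
  ∈⇒↭∷ {x} x∈L with ∈-∃++ x∈L
  ... | L₁ , L₂ , refl = L₁ ++ L₂ , shift x L₁ L₂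

  ∷↭++-split : ∀ {c : X} {K} L₁ L₂ → c ∷ K ↭ L₁ ++ L₂ →
               (∃ λ K₁ → L₁ ↭ c ∷ K₁ × K ↭ K₁ ++ L₂) ⊎
               (∃ λ K₂ → L₂ ↭ c ∷ K₂ × K ↭ L₁ ++ K₂)
  ∷↭++-split {c} L₁ L₂ p with ∈-++⁻ L₁ (∈-resp-↭ p (here refl))
  ... | inj₁ c∈L₁ with ∈⇒↭∷ c∈L₁
  ...   | K₁ , L₁↭ = inj₁ (K₁ , L₁↭ , drop-∷ (p ⟫ ++⁺ʳ L₂ L₁↭))
  ∷↭++-split {c} L₁ L₂ p | inj₂ c∈L₂ with ∈⇒↭∷ c∈L₂
  ...   | K₂ , L₂↭ = inj₂ (K₂ , L₂↭ , drop-∷ (p ⟫ ++⁺ˡ L₁ L₂↭ ⟫ shift c L₁ K₂))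

  [_]↭∷-inv : ∀ (x : X) {c K} → [ x ] ↭ c ∷ K → x ≡ c × K ≡ []
  [ x ]↭∷-inv {K = []} p with ↭-singleton-inv (↭-sym p)
  ... | refl = refl , refl
  [ x ]↭∷-inv {K = _ ∷ _} p with ↭-length p
  ... | ()

  [_]≁∷∷ : ∀ (x : X) {c d K} → [ x ] ↭ c ∷ d ∷ K → ⊥
  [ x ]≁∷∷ p with ↭-length p
  ... | ()

StepInto : Proc → Act → List Proc → Set
StepInto A α L = ∃ λ A' → (A —[ α ]→ A') × (components A' ↭ L)

StepInto-resp-↭ : ∀ {A α L L'} → L ↭ L' → StepInto A α L → StepInto A α L'
StepInto-resp-↭ L↭L' (A' , t , p) = A' , t , p ⟫ L↭L'

StepInto-parL : ∀ {A α L} B → StepInto A α L → StepInto (A ∥ B) α (L ++ components B)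
StepInto-parL B (A' , t , p) = A' ∥ B , parL t , ++⁺ʳ (components B) p

StepInto-parR : ∀ {B α L} A → StepInto B α L → StepInto (A ∥ B) α (components A ++ L)
StepInto-parR A (B' , t , p) = A ∥ B' , parR t , ++⁺ˡ (components A) p

StepInto-commL : ∀ {A B a L M} → StepInto A (ō a) L → StepInto B (ι a) M →
                 StepInto (A ∥ B) τ (L ++ M)
StepInto-commL (A' , t , p) (B' , u , q) = A' ∥ B' , commL t u , ++⁺ p q

StepInto-commR : ∀ {A B a L M} → StepInto A (ι a) L → StepInto B (ō a) M →
                 StepInto (A ∥ B) τ (L ++ M)
StepInto-commR (A' , u , p) (B' , t , q) = A' ∥ B' , commR t u , ++⁺ p q

atom-step : ∀ {A c c' α K} → [ A ] ↭ c ∷ K → c —[ α ]→ c' →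
            StepInto A α (components c' ++ K)
atom-step {A} p t with [ A ]↭∷-inv p
... | refl , refl = _ , t , ↭-reflexive (sym (++-identityʳ _))

component-step : ∀ A {c c' α K} → components A ↭ c ∷ K → c —[ α ]→ c' →
                 StepInto A α (components c' ++ K)
component-step 𝟎         = atom-step
component-step (inp a P) = atom-step
component-step (out a P) = atom-step
component-step (! P)     = atom-step
component-step (A₁ ∥ A₂) {c' = c'} p t
  with ∷↭++-split (components A₁) (components A₂) (↭-sym p)
... | inj₁ (K₁ , p₁ , K↭) =
  StepInto-resp-↭
    (↭-reflexive (++-assoc (components c') K₁ (components A₂))
     ⟫ ++⁺ˡ (components c') (↭-sym K↭))
    (StepInto-parL A₂ (component-step A₁ p₁ t))
... | inj₂ (K₂ , p₂ , K↭) =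
  StepInto-resp-↭
    (shifts (components A₁) (components c') ⟫ ++⁺ˡ (components c') (↭-sym K↭))
    (StepInto-parR A₁ (component-step A₂ p₂ t))

components-sync : ∀ A {a c c' d d' K} → components A ↭ c ∷ d ∷ K →
                  c —[ ō a ]→ c' → d —[ ι a ]→ d' →
                  StepInto A τ (components c' ++ components d' ++ K)
components-sync 𝟎         p = ⊥-elim ([ _ ]≁∷∷ p)
components-sync (inp a P) p = ⊥-elim ([ _ ]≁∷∷ p)
components-sync (out a P) p = ⊥-elim ([ _ ]≁∷∷ p)
components-sync (! P)     p = ⊥-elim ([ _ ]≁∷∷ p)
components-sync (A₁ ∥ A₂) {c = c} {c'} {d' = d'} p t u
  with ∷↭++-split (components A₁) (components A₂) (↭-sym p)
... | inj₁ (K₁ , p₁ , dK↭) with ∷↭++-split K₁ (components A₂) dK↭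
...   | inj₁ (K₁' , K₁↭ , K↭) =
  StepInto-resp-↭
    (solve 4 (λ x y k a → (x ⊕ (y ⊕ k)) ⊕ a ⊜ x ⊕ (y ⊕ (k ⊕ a))) ↭-refl
       (components c') (components d') K₁' (components A₂)
     ⟫ ++⁺ˡ (components c') (++⁺ˡ (components d') (↭-sym K↭)))
    (StepInto-parL A₂ (components-sync A₁ (p₁ ⟫ prep c K₁↭) t u))
...   | inj₂ (K₂ , p₂ , K↭) =
  StepInto-resp-↭
    (solve 4 (λ x k y l → (x ⊕ k) ⊕ (y ⊕ l) ⊜ x ⊕ (y ⊕ (k ⊕ l))) ↭-refl
       (components c') K₁ (components d') K₂
     ⟫ ++⁺ˡ (components c') (++⁺ˡ (components d') (↭-sym K↭)))
    (StepInto-commL (component-step A₁ p₁ t) (component-step A₂ p₂ u))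
components-sync (A₁ ∥ A₂) {c = c} {c'} {d' = d'} p t u | inj₂ (K₂ , p₂ , dK↭)
  with ∷↭++-split (components A₁) K₂ dK↭
...   | inj₁ (K₁ , p₁ , K↭) =
  StepInto-resp-↭
    (solve 4 (λ y k x l → (y ⊕ k) ⊕ (x ⊕ l) ⊜ x ⊕ (y ⊕ (k ⊕ l))) ↭-refl
       (components d') K₁ (components c') K₂
     ⟫ ++⁺ˡ (components c') (++⁺ˡ (components d') (↭-sym K↭)))
    (StepInto-commR (component-step A₁ p₁ u) (component-step A₂ p₂ t))
...   | inj₂ (K₂' , K₂↭ , K↭) =
  StepInto-resp-↭
    (shifts (components A₁) (components c')
     ⟫ ++⁺ˡ (components c') (shifts (components A₁) (components d'))
     ⟫ ++⁺ˡ (components c') (++⁺ˡ (components d') (↭-sym K↭)))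
    (StepInto-parR A₁ (components-sync A₂ (p₂ ⟫ prep c K₂↭) t u))

data Localised (C : Proc) : Act → Proc → Set where
  solo : ∀ {α c c' K C'} → components C ↭ c ∷ K → c —[ α ]→ c' →
         components C' ↭ components c' ++ K → Localised C α C'
  sync : ∀ {a c c' d d' K C'} → components C ↭ c ∷ d ∷ K →
         c —[ ō a ]→ c' → d —[ ι a ]→ d' →
         components C' ↭ components c' ++ components d' ++ K → Localised C τ C'

Localised-atom : ∀ {C α C'} → components C ≡ [ C ] → C —[ α ]→ C' → Localised C α C'
Localised-atom atomic t = solo (↭-reflexive atomic) t (↭-reflexive (sym (++-identityʳ _)))

Localised-parL : ∀ {P α P'} Q → Localised P α P' → Localised (P ∥ Q) α (P' ∥ Q)
Localised-parL Q (solo {c' = c'} {K} p s q) =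
  solo (++⁺ʳ (components Q) p) s
       (++⁺ʳ (components Q) q ⟫ ↭-reflexive (++-assoc (components c') K (components Q)))
Localised-parL Q (sync {c' = c'} {d' = d'} {K} p s u q) =
  sync (++⁺ʳ (components Q) p) s u
       (++⁺ʳ (components Q) q
        ⟫ solve 4 (λ x y k q → (x ⊕ (y ⊕ k)) ⊕ q ⊜ x ⊕ (y ⊕ (k ⊕ q))) ↭-refl
            (components c') (components d') K (components Q))

Localised-parR : ∀ {P α P'} Q → Localised P α P' → Localised (Q ∥ P) α (Q ∥ P')
Localised-parR Q (solo {c = c} {c'} {K} p s q) =
  solo (++⁺ˡ (components Q) p ⟫ shift c (components Q) K) s
       (++⁺ˡ (components Q) q ⟫ shifts (components Q) (components c'))
Localised-parR Q (sync {c = c} {c'} {d} {d'} {K} p s u q) =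
  sync (++⁺ˡ (components Q) p ⟫ shift c (components Q) (d ∷ K) ⟫ prep c (shift d (components Q) K))
       s u
       (++⁺ˡ (components Q) q ⟫ shifts (components Q) (components c')
        ⟫ ++⁺ˡ (components c') (shifts (components Q) (components d')))

localise : ∀ {C α C'} → C —[ α ]→ C' → Localised C α C'
localise t@input         = Localised-atom refl t
localise t@output        = Localised-atom refl t
localise t@(rep _)       = Localised-atom refl t
localise t@(repComm _ _) = Localised-atom refl t
localise (parL {Q = Q} t) = Localised-parL Q (localise t)
localise (parR {Q = Q} t) = Localised-parR Q (localise t)
localise (commL t u) with localise t | localise u
... | solo {c = c} {c'} {K₁} p s q | solo {c = d} {d'} {K₂} p' s' q' =
  sync (++⁺ p p' ⟫ prep c (shift d K₁ K₂)) s s'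
       (++⁺ q q' ⟫ ↭-reflexive (++-assoc (components c') K₁ _)
        ⟫ ++⁺ˡ (components c') (shifts K₁ (components d')))
localise (commR t u) with localise t | localise u
... | solo {c = c} {c'} {K₁} p s q | solo {c = d} {d'} {K₂} p' s' q' =
  sync (++⁺ p' p ⟫ interchange [ d ] K₂ [ c ] K₁) s s'
       (++⁺ q' q ⟫ interchange (components d') K₂ (components c') K₁)
  where
  interchange : ∀ (y k x l : List Proc) → (y ++ k) ++ (x ++ l) ↭ x ++ y ++ k ++ l
  interchange = solve 4 (λ y k x l → (y ⊕ k) ⊕ (x ⊕ l) ⊜ x ⊕ (y ⊕ (k ⊕ l))) ↭-refl

step-in-context : ∀ {A C α C' K} → C —[ α ]→ C' → components A ↭ components C ++ K →
                  StepInto A α (components C' ++ K)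
step-in-context {A} {K = K} t p with localise t
... | solo {c' = c'} {K'} q s r =
  StepInto-resp-↭ (↭-reflexive (sym (++-assoc (components c') K' K)) ⟫ ++⁺ʳ K (↭-sym r))
    (component-step A (p ⟫ ++⁺ʳ K q) s)
... | sync {c' = c'} {d' = d'} {K'} q s u r =
  StepInto-resp-↭
    (solve 4 (λ x y k l → x ⊕ (y ⊕ (k ⊕ l)) ⊜ (x ⊕ (y ⊕ k)) ⊕ l) ↭-refl
       (components c') (components d') K' K
     ⟫ ++⁺ʳ K (↭-sym r))
    (components-sync A (p ⟫ ++⁺ʳ K q) s u)

steps-in-context : ∀ {A C C' K} → C ⇒ C' → components A ↭ components C ++ K →
                   ∃ λ A' → (A ⇒ A') × (components A' ↭ components C' ++ K)
steps-in-context ε p = _ , ε , p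
steps-in-context (t ◅ ts) p with step-in-context t p
... | A₁ , s , p₁ with steps-in-context ts p₁
...   | A₂ , ss , p₂ = A₂ , s ◅ ss , p₂

replication-persists : ∀ {R X α X'} → ! R ∈ components X → X —[ α ]→ X' →
                       ! R ∈ components X'
replication-persists (here ()) input
replication-persists (there ()) input
replication-persists (here ()) output
replication-persists (there ()) output
replication-persists {X' = Q' ∥ _} m (rep t) = ∈-++⁺ʳ (components Q') m
replication-persists {X' = P' ∥ P'' ∥ _} m (repComm t u) =
  ∈-++⁺ʳ (components P') (∈-++⁺ʳ (components P'') m)
replication-persists {X = P ∥ Q} m (parL t) with ∈-++⁻ (components P) m
... | inj₁ m' = ∈-++⁺ˡ (replication-persists m' t)
... | inj₂ m' = ∈-++⁺ʳ _ m'
replication-persists {X = Q ∥ P} m (parR t) with ∈-++⁻ (components Q) m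
... | inj₁ m' = ∈-++⁺ˡ m'
... | inj₂ m' = ∈-++⁺ʳ (components Q) (replication-persists m' t)
replication-persists {X = P ∥ Q} m (commL t u) with ∈-++⁻ (components P) m
... | inj₁ m' = ∈-++⁺ˡ (replication-persists m' t)
... | inj₂ m' = ∈-++⁺ʳ _ (replication-persists m' u)
replication-persists {X = Q ∥ P} m (commR t u) with ∈-++⁻ (components Q) m
... | inj₁ m' = ∈-++⁺ˡ (replication-persists m' u)
... | inj₂ m' = ∈-++⁺ʳ _ (replication-persists m' t)

replication-persists-⇒ : ∀ {R X X'} → ! R ∈ components X → X ⇒ X' → ! R ∈ components X'
replication-persists-⇒ m ε        = m
replication-persists-⇒ m (t ◅ ts) = replication-persists-⇒ (replication-persists m t) ts

Divergent-◅ : ∀ {B C} → B —τ→ C → Divergent C → Divergent B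
Divergent-◅ {B} t (f , refl , steps) = g , refl , steps′
  where
  g : ℕ → Proc
  g zero    = B
  g (suc n) = f n
  steps′ : ∀ n → g n —τ→ g (suc n)
  steps′ zero    = t
  steps′ (suc n) = steps n

Divergent-⇒ : ∀ {B C} → B ⇒ C → Divergent C → Divergent B
Divergent-⇒ ε        d = d
Divergent-⇒ (t ◅ ts) d = Divergent-◅ t (Divergent-⇒ ts d)

Divergent-in-context : ∀ {A C K} → components A ↭ components C ++ K → Divergent C → Divergent A
Divergent-in-context {A} {K = K} p (f , refl , steps) =
  (λ n → proj₁ (trace n)) , refl , λ n → proj₁ (proj₂ (follow n))
  where
  trace : (n : ℕ) → Σ Proc λ A' → components A' ↭ components (f n) ++ K
  follow : (n : ℕ) → StepInto (proj₁ (trace n)) τ (components (f (suc n)) ++ K)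
  trace zero    = A , p
  trace (suc n) = proj₁ (follow n) , proj₂ (proj₂ (follow n))
  follow n      = step-in-context (steps n) (proj₂ (trace n))

weak-step : ∀ {B B₁ α B₂} → B ⇒ B₁ → B₁ —[ α ]→ B₂ → B =[ α ]⇒ B₂
weak-step {α = ι a} path t = _ , _ , path , t , ε
weak-step {α = ō a} path t = _ , _ , path , t , ε
weak-step {α = τ}   path t = path ◅◅ (t ◅ ε)

module Replication (P : Proc) where

  Residue : List Proc → Set
  Residue G = ∃ λ X → (! P) ⇒ X × (components X ↭ ! P ∷ G)

  infix 4 _∼_
  data _∼_ (A B : Proc) : Set where
    related : ∀ {D G H} → Residue G → Residue H →
              components A ↭ ! P ∷ D ++ G → components B ↭ ! P ∷ D ++ H → A ∼ B

  ∼-sym : ∀ {A B} → A ∼ B → B ∼ A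
  ∼-sym (related g h pA pB) = related h g pB pA

  catch-up : ∀ {A B} → A ∼ B →
             ∃ λ H → Residue H × ∃ λ B₁ → (B ⇒ B₁) × (components B₁ ↭ components A ++ H)
  catch-up (related {D} {G} {H} (X , runG , pX) h pA pB) with steps-in-context runG pB
  ... | B₁ , path , p₁ = H , h , B₁ , path ,
        (p₁ ⟫ ++⁺ʳ (D ++ H) pX
            ⟫ solve 4 (λ x g d k → (x ⊕ g) ⊕ (d ⊕ k) ⊜ (x ⊕ (d ⊕ g)) ⊕ k) ↭-refl
                [ ! P ] G D H
            ⟫ ++⁺ʳ H (↭-sym pA))

  ∼-simulate : ∀ {A B α A'} → A ∼ B → A —[ α ]→ A' →
               ∃ λ B' → (B =[ α ]⇒ B') × A' ∼ B'
  ∼-simulate A∼B@(related _ _ pA _) t with catch-up A∼B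
  ... | H , h , B₁ , path , p₁
    with step-in-context t p₁ | ∈⇒↭∷ (replication-persists (∈-resp-↭ (↭-sym pA) (here refl)) t)
  ...   | B₂ , s , p₂ | D' , pA' =
    B₂ , weak-step path s ,
    related (! P , ε , ↭-refl) h
            (pA' ⟫ ↭-reflexive (sym (++-identityʳ (! P ∷ D'))))
            (p₂ ⟫ ++⁺ʳ H pA')

  ∼-divergent : ∀ {A B} → A ∼ B → Divergent A → Divergent B
  ∼-divergent A∼B d with catch-up A∼B
  ... | _ , _ , _ , path , p₁ = Divergent-⇒ path (Divergent-in-context p₁ d)

  ∼-isWeakBisim : IsWeakBisim _∼_
  ∼-isWeakBisim = record
    { sym      = ∼-sym
    ; divSens  = λ A∼B → ∼-divergent A∼B , ∼-divergent (∼-sym A∼B)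
    ; simulate = ∼-simulate
    }

  ⇒-∼ : ∀ {P'} → (! P) ⇒ P' → ! P ∼ P'
  ⇒-∼ path with ∈⇒↭∷ (replication-persists-⇒ {X = ! P} (here refl) path)
  ... | H , pP' = related {D = []} (! P , ε , ↭-refl) (_ , path , pP') ↭-refl pP'

lemma15 : ∀ (P P' : Proc) → (! P) ⇒ P' → (! P) ≈ P'
lemma15 P P' path = _∼_ , ∼-isWeakBisim , ⇒-∼ path
  where open Replication P
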